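{- For every $k \in \mathbb{N}_0$ and every clause-set $F \in \mathrm{WC}_k$ we have $c(F) \ge \tau(\mathcal{T}_k(F))$.
   Context: Clauses are finite sets of literals without complementary pair, clause-sets finite sets of clauses, $c(F)=|F|$. A partial assignment $\varphi$ applied to $F$ ($\varphi*F$) removes satisfied clauses and falsified literals. Prime implicates $\mathrm{prc}_0(F)$: inclusion-minimal clauses $C$ with $F\models C$. $\overline{C}$ is the set of complements of literals in $C$. W-hardness $\mathrm{whd}(F)$: for unsatisfiable $F$ the minimum $k$ such that there is a resolution tree deriving $\bot$ from $F$ in which every resolution step has a parent clause of length at most $k$ (resolution: $C,D$ with $C\cap\overline{D}=\{x\}$ yield $(C\cup D)\setminus\{x,\overline{x}\}$); $\mathrm{whd}(\top)=0$ for the empty clause-set $\top$; for satisfiable $F\ne\top$ the maximum of $\mathrm{whd}(\varphi*F)$ over partial assignments $\varphi$ with $\varphi*F$ unsatisfiable. $\mathrm{WC}_k := \{F : \mathrm{whd}(F)\le k\}$. Trigger hypergraph $\mathcal{T}_k(F)$: vertex set $\mathrm{prc}_0(F)$, hyperedges $E^k_C := \{C'\in\mathrm{prc}_0(F) : C'\cap\overline{C}=\emptyset \text{ and } |C'\setminus C|\le k\}$ for $C\in\mathrm{prc}_0(F)$. $\tau(G)$ is the transversal number: minimum size of a vertex set meeting every hyperedge. -}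

module Defs where

open import Data.Nat using (ℕ; _≤_)
import Data.Nat as N
open import Data.Bool using (Bool; true; false; not; if_then_else_)
import Data.Bool as B
open import Data.Maybe using (Maybe; just; nothing)
open import Data.Product using (Σ; ∃; ∃-syntax; _×_; _,_)
open import Data.Product.Properties using (≡-dec)
open import Data.Sum using (_⊎_)
open import Data.List using (List; []; length; map; filter; filterᵇ)
open import Data.Bool.ListAction using (any)
open import Data.List.Relation.Unary.All using (All)
open import Data.List.Relation.Unary.Any using (Any)
open import Data.List.Relation.Unary.Unique.Propositional using (Unique)
open import Data.List.Relation.Unary.AllPairs using (AllPairs)
open import Data.List.Membership.Propositional using (_∈_; _∉_)
open import Relation.Binary.PropositionalEquality using (_≡_; _≢_)
open import Relation.Binary.Definitions using (DecidableEquality)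
open import Relation.Nullary using (¬_; ¬?)
open import Function using (_⇔_)

-- Literals, clauses, clause-sets
-- A literal is a pair (variable , sign); (v , true) is v, (v , false) is ¬v.

Lit : Set
Lit = ℕ × Bool

_≟L_ : DecidableEquality Lit
_≟L_ = ≡-dec N._≟_ B._≟_

open import Data.List.Membership.DecPropositional _≟L_ using (_∈?_)

compl : Lit → Lit
compl (v , b) = (v , not b)

-- clauses are represented by duplicate-free lists of literals (read as sets)
Clause : Set
Clause = List Lit

IsClause : Clause → Set
IsClause C = Unique C × (∀ l → l ∈ C → compl l ∉ C)

_⊆_ : Clause → Clause → Set
C ⊆ D = ∀ l → l ∈ C → l ∈ D

_≐_ : Clause → Clause → Set
C ≐ D = C ⊆ D × D ⊆ C

ClauseSet : Set
ClauseSet = List Clause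

IsClauseSet : ClauseSet → Set
IsClauseSet F = All IsClause F × AllPairs (λ C D → ¬ (C ≐ D)) F

c : ClauseSet → ℕ
c F = length F

Assignment : Set
Assignment = ℕ → Bool

litTrue : Assignment → Lit → Set
litTrue α (v , b) = α v ≡ b

satClause : Assignment → Clause → Set
satClause α C = Any (litTrue α) C

satCS : Assignment → ClauseSet → Set
satCS α F = All (satClause α) F

Satisfiable : ClauseSet → Set
Satisfiable F = ∃[ α ] satCS α F

Unsatisfiable : ClauseSet → Set
Unsatisfiable F = ¬ Satisfiable F

_⊨_ : ClauseSet → Clause → Set
F ⊨ C = ∀ (α : Assignment) → satCS α F → satClause α C

PAssignment : Set
PAssignment = ℕ → Maybe Bool

pTrue : PAssignment → Lit → Bool
pTrue φ (v , b) with φ v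
... | just x  = if x then b else not b
... | nothing = false

pFalse : PAssignment → Lit → Bool
pFalse φ (v , b) with φ v
... | just x  = if x then not b else b
... | nothing = false

anyᵇ : (Lit → Bool) → Clause → Bool
anyᵇ p C = any p C

_*_ : PAssignment → ClauseSet → ClauseSet
φ * F = map (filterᵇ (λ l → not (pFalse φ l)))
            (filterᵇ (λ C → not (anyᵇ (pTrue φ) C)) F)

IsResolvent : Clause → Clause → Lit → Clause → Set
IsResolvent C D x E =
  x ∈ C × compl x ∈ D × (∀ l → l ∈ C → compl l ∈ D → l ≡ x) ×
  (∀ l → l ∈ E ⇔ ((l ∈ C ⊎ l ∈ D) × l ≢ x × l ≢ compl x))

data Deriv (k : ℕ) (F : ClauseSet) : Clause → Set where
  axiom : ∀ {C} → C ∈ F → Deriv k F C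
  res   : ∀ {C D E} (x : Lit) → Deriv k F C → Deriv k F D →
          IsResolvent C D x E → Unique E →
          (length C ≤ k ⊎ length D ≤ k) → Deriv k F E

-- "min{k' : refutable with width k'} ≤ k"
RefutableWithin : ℕ → ClauseSet → Set
RefutableWithin k F = ∃[ k' ] (k' ≤ k × Deriv k' F [])

-- W-hardness: WhdLe k F  ⇔  whd(F) ≤ k ; WC_k = { F : WhdLe k F }

WhdLe : ℕ → ClauseSet → Set
WhdLe k F =
  -- unsatisfiable case: whd(F) = min width of a tree refutation
  (Unsatisfiable F → RefutableWithin k F) ×
  -- F = ⊤: whd = 0 ≤ k, no condition
  -- satisfiable F ≠ ⊤: max over φ with φ*F unsatisfiable of whd(φ*F)
  ((Satisfiable F × F ≢ []) →
     ∀ (φ : PAssignment) → Unsatisfiable (φ * F) → RefutableWithin k (φ * F))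

WC : ℕ → ClauseSet → Set
WC k F = WhdLe k F

IsPrimeImplicate : ClauseSet → Clause → Set
IsPrimeImplicate F C =
  IsClause C × F ⊨ C ×
  (∀ C' → IsClause C' → C' ⊆ C → F ⊨ C' → C ⊆ C')

diffSize : Clause → Clause → ℕ
diffSize C' C = length (filter (λ l → ¬? (l ∈? C)) C')

InHyperedge : ℕ → ClauseSet → Clause → Clause → Set
InHyperedge k F C C' =
  IsPrimeImplicate F C' × (∀ l → l ∈ C' → compl l ∉ C) × diffSize C' C ≤ k

-- a transversal of T_k(F): a list of vertices (prime implicates) meeting
-- every hyperedge E^k_C, C ∈ prc_0(F); its size is its length
IsTransversal : ℕ → ClauseSet → List Clause → Set
IsTransversal k F T =
  All (IsPrimeImplicate F) T ×
  (∀ C → IsPrimeImplicate F C → Any (InHyperedge k F C) T)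

IsTransversalNumber : ℕ → ClauseSet → ℕ → Set
IsTransversalNumber k F t =
  (∃[ T ] (IsTransversal k F T × length T ≡ t)) ×
  (∀ T → IsTransversal k F T → t ≤ length T)

module Submission where

-- Let C be a prime implicate of F and φ the partial assignment falsifying C. As F ⊨ C, φ * F
-- is unsatisfiable, so whd(F) ≤ k gives a refutation of φ * F in which every step has a
-- parent of length ≤ k; following those parents up the tree ends in an axiom of length ≤ k.
-- That axiom is D ∖ C for a clause D ∈ F untouched by φ, so D ∩ C̄ = ∅ and |D ∖ C| ≤ k (for
-- unsatisfiable F, C = ⊥ and the refutation of F itself supplies D). Both properties pass to
-- every prime implicate contained in D, hence one prime implicate inside each clause of F
-- forms a transversal of T_k(F) of size at most c(F). Choosing these and splitting on
-- satisfiability is classical, which is harmless because t ≤ c(F) is decidable.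

open import Defs
open import Data.Nat using (ℕ; _≤_; _<_; _≤?_; z≤n)
open import Data.Nat.Induction using (<-wellFounded)
open import Data.Nat.Properties using (≤-trans; ≤-reflexive)
open import Data.Bool using (true; false; not; T; T?)
open import Data.Bool.Properties using (not-involutive)
open import Data.Maybe using (just; nothing; fromMaybe)
open import Data.Product using (∃-syntax; _×_; _,_; proj₁)
open import Data.Sum using (inj₁; inj₂)
open import Data.Empty using (⊥-elim)
open import Data.List using ([]; _∷_; length; filter; filterᵇ)
open import Data.List.Properties using (length-filter; filter-notAll)
open import Data.List.Relation.Unary.All as All using (All; []; _∷_)
open import Data.List.Relation.Unary.Any as Any using (Any; here; there)
open import Data.List.Relation.Unary.Any.Properties using (any⁺; any⁻)
open import Data.List.Relation.Unary.AllPairs using ([])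
open import Data.List.Relation.Unary.Unique.Propositional.Properties as Unique using ()
open import Data.List.Relation.Binary.Pointwise using (Pointwise; []; _∷_)
open import Data.List.Relation.Binary.Pointwise.Properties using (Pointwise-length)
open import Data.List.Relation.Binary.Sublist.Propositional as Sublist
  using (⊆-refl; ⊆-trans) renaming (_⊆_ to _⊑_)
open import Data.List.Relation.Binary.Sublist.Propositional.Properties
  using (filter-⊆; filter⁺; length-mono-≤)
open import Data.List.Membership.Propositional using (_∈_; _∉_; find; lose)
open import Data.List.Membership.Propositional.Properties using (∈-map⁺; ∈-map⁻; ∈-filter⁺; ∈-filter⁻)
open import Data.List.Membership.DecPropositional _≟L_ using (_∈?_)
open import Effect.Monad using (RawMonad)
open import Function using (_on_; _$_; _∘_)
open import Level using (0ℓ)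
open import Induction.WellFounded using (Acc; acc)
open import Relation.Binary.Construct.On as On using ()
open import Relation.Binary.PropositionalEquality using (_≡_; refl; sym; subst)
open import Relation.Nullary using (¬_; ¬?; Dec; yes; no)
open import Relation.Nullary.Decidable using (decidable-stable; ¬¬-excluded-middle)
open import Relation.Unary using (Pred; Decidable)
open import Relation.Nullary.Negation using (¬¬-Monad)

open RawMonad (¬¬-Monad {0ℓ})

¬T⇒T-not : ∀ {b} → ¬ T b → T (not b)
¬T⇒T-not {false} _  = _
¬T⇒T-not {true}  ¬t = ¬t _

T-not⇒¬T : ∀ {b} → T (not b) → ¬ T b
T-not⇒¬T {false} _ ()

_◃_ : PAssignment → Assignment → Assignment
(φ ◃ α) v = fromMaybe (α v) (φ v)

◃-pTrue : ∀ φ α l → T (pTrue φ l) → litTrue (φ ◃ α) l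
◃-pTrue φ α (v , b) t with φ v
◃-pTrue φ α (v , true)  t | just true  = refl
◃-pTrue φ α (v , false) t | just false = refl

◃-pFalse : ∀ φ α l → T (pFalse φ l) → ¬ litTrue (φ ◃ α) l
◃-pFalse φ α (v , b) f with φ v
◃-pFalse φ α (v , false) f | just true  = λ ()
◃-pFalse φ α (v , true)  f | just false = λ ()

◃-unfalsified : ∀ φ α l → T (not (pFalse φ l)) → litTrue α l → litTrue (φ ◃ α) l
◃-unfalsified φ α (v , b) nf αl with φ v
◃-unfalsified φ α (v , true)  nf αl | just true  = refl
◃-unfalsified φ α (v , false) nf αl | just false = refl
◃-unfalsified φ α (v , b)     nf αl | nothing    = αl

pTrue≡pFalse-compl : ∀ φ l → pTrue φ l ≡ pFalse φ (compl l)
pTrue≡pFalse-compl φ (v , b) with φ v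
... | just true  = sym (not-involutive b)
... | just false = refl
... | nothing    = refl

◃-satisfies : ∀ φ α F → satCS α (φ * F) → satCS (φ ◃ α) F
◃-satisfies φ α F sat = All.tabulate satisfied
  where
  satisfied : ∀ {D} → D ∈ F → satClause (φ ◃ α) D
  satisfied {D} D∈F with T? (anyᵇ (pTrue φ) D)
  ... | yes t  = Any.map (◃-pTrue φ α _) (any⁻ (pTrue φ) D t)
  ... | no nt  =
    let restricted∈ = ∈-map⁺ (filterᵇ (λ l → not (pFalse φ l)))
                        (∈-filter⁺ (λ C → T? (not (anyᵇ (pTrue φ) C))) D∈F (¬T⇒T-not nt))
        l , l∈ , αl = find (All.lookup sat restricted∈)
        l∈D , nf = ∈-filter⁻ (λ l → T? (not (pFalse φ l))) {xs = D} l∈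
    in lose l∈D (◃-unfalsified φ α l nf αl)

∈-*⁻ : ∀ φ F {D'} → D' ∈ φ * F →
  ∃[ D ] (D ∈ F × T (not (anyᵇ (pTrue φ) D)) × D' ≡ filterᵇ (λ l → not (pFalse φ l)) D)
∈-*⁻ φ F D'∈ =
  let D , D∈ , D'≡ = ∈-map⁻ (filterᵇ (λ l → not (pFalse φ l))) D'∈
      D∈F , unsat  = ∈-filter⁻ (λ C → T? (not (anyᵇ (pTrue φ) C))) {xs = F} D∈
  in D , D∈F , unsat , D'≡

falsify : Clause → PAssignment
falsify C v with (v , true) ∈? C | (v , false) ∈? C
... | yes _ | _     = just false
... | no _  | yes _ = just true
... | no _  | no _  = nothing

module _ {C : Clause} where

  pFalse-falsify : IsClause C → ∀ {l} → l ∈ C → T (pFalse (falsify C) l)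
  pFalse-falsify _ {v , b} l∈C with (v , true) ∈? C | (v , false) ∈? C
  pFalse-falsify _             {v , true}  l∈C | yes _  | _     = _
  pFalse-falsify (_ , noClash) {v , false} l∈C | yes p  | _     = ⊥-elim (noClash _ p l∈C)
  pFalse-falsify _             {v , true}  l∈C | no ¬p  | _     = ⊥-elim (¬p l∈C)
  pFalse-falsify _             {v , false} l∈C | no _   | yes _ = _
  pFalse-falsify _             {v , false} l∈C | no _   | no ¬q = ⊥-elim (¬q l∈C)

  pFalse-falsify-∉ : ∀ {l} → l ∉ C → T (not (pFalse (falsify C) l))
  pFalse-falsify-∉ {v , b} l∉C with (v , true) ∈? C | (v , false) ∈? C
  pFalse-falsify-∉ {v , true}  l∉C | yes p | _     = ⊥-elim (l∉C p)
  pFalse-falsify-∉ {v , false} l∉C | yes _ | _     = _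
  pFalse-falsify-∉ {v , true}  l∉C | no _  | yes _ = _
  pFalse-falsify-∉ {v , false} l∉C | no _  | yes q = ⊥-elim (l∉C q)
  pFalse-falsify-∉ {v , b}     l∉C | no _  | no _  = _

  pTrue-falsify : IsClause C → ∀ {l} → compl l ∈ C → T (pTrue (falsify C) l)
  pTrue-falsify cC {l} l̅∈C =
    subst T (sym (pTrue≡pFalse-compl (falsify C) l)) (pFalse-falsify cC l̅∈C)

  falsify-◃ : IsClause C → ∀ α → ¬ satClause (falsify C ◃ α) C
  falsify-◃ cC α sat =
    let l , l∈C , lTrue = find sat in ◃-pFalse (falsify C) α l (pFalse-falsify cC l∈C) lTrue

  entailed⇒falsify-unsat : ∀ {F} → IsClause C → F ⊨ C → Unsatisfiable (falsify C * F)
  entailed⇒falsify-unsat {F} cC F⊨C (α , sat) =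
    falsify-◃ cC α (F⊨C _ (◃-satisfies (falsify C) α F sat))

short-leaf : ∀ {k G E} → Deriv k G E → length E ≤ k → ∃[ D ] (D ∈ G × length D ≤ k)
short-leaf (axiom D∈G) short = _ , D∈G , short
short-leaf (res _ d _ _ _ (inj₁ short)) _ = short-leaf d short
short-leaf (res _ _ d _ _ (inj₂ short)) _ = short-leaf d short

refutable⇒short-clause : ∀ {k G} → RefutableWithin k G → ∃[ D ] (D ∈ G × length D ≤ k)
refutable⇒short-clause (k' , k'≤k , refutation) =
  let D , D∈G , short = short-leaf refutation z≤n in D , D∈G , ≤-trans short k'≤k

Near : ℕ → Clause → Clause → Set
Near k C D = (∀ l → l ∈ D → compl l ∉ C) × diffSize D C ≤ k

Near-⊑ : ∀ {k C P D} → P ⊑ D → Near k C D → Near k C P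
Near-⊑ {C = C} P⊑D (disjoint , small) =
  (λ l l∈P → disjoint l (Sublist.lookup P⊑D l∈P)) ,
  ≤-trans (length-mono-≤ (filter⁺ outside outside (λ { refl p → p }) P⊑D)) small
  where
  outside : Decidable (_∉ C)
  outside l = ¬? (l ∈? C)

diffSize≤length : ∀ D C → diffSize D C ≤ length D
diffSize≤length D C = length-filter (λ l → ¬? (l ∈? C)) D

diffSize≤restriction : ∀ C D → diffSize D C ≤ length (filterᵇ (λ l → not (pFalse (falsify C) l)) D)
diffSize≤restriction C D =
  length-mono-≤ (filter⁺ outside unfalsified (λ { refl l∉C → pFalse-falsify-∉ l∉C }) (⊆-refl {x = D}))
  where
  outside : Decidable (_∉ C)
  outside l = ¬? (l ∈? C)
  unfalsified : Decidable (λ l → T (not (pFalse (falsify C) l)))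
  unfalsified l = T? (not (pFalse (falsify C) l))

-- D' is D minus the literals of C; D itself survived in falsify C * F because it contains no
-- complement of a literal of C.
restriction-near : ∀ {k C F D'} → IsClause C → D' ∈ falsify C * F → length D' ≤ k →
  ∃[ D ] (D ∈ F × Near k C D)
restriction-near {C = C} {F} cC D'∈ short with ∈-*⁻ (falsify C) F D'∈
... | D , D∈F , unsat , refl =
  D , D∈F ,
  (λ l l∈D l̅∈C → T-not⇒¬T unsat (any⁺ (pTrue (falsify C)) (lose l∈D (pTrue-falsify cC l̅∈C)))) ,
  ≤-trans (diffSize≤restriction C D) short

prime-implicate-near : ∀ {k F C} → WC k F → IsPrimeImplicate F C →
  Dec (Satisfiable F) → ∃[ D ] (D ∈ F × Near k C D)
prime-implicate-near {C = C} (refute , _) (_ , _ , minimal) (no unsat) =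
  let D , D∈F , short = refutable⇒short-clause (refute unsat)
  in D , D∈F , (λ _ _ → C-empty) , ≤-trans (diffSize≤length D C) short
  where
  C-empty : ∀ {l} → l ∉ C
  C-empty l∈C with () ← minimal [] ([] , λ _ ()) (λ _ ()) (λ α sat → ⊥-elim (unsat (α , sat))) _ l∈C
prime-implicate-near {F = []} _ (cC , F⊨C , _) (yes _) =
  ⊥-elim (falsify-◃ cC (λ _ → true) (F⊨C _ []))
prime-implicate-near {F = F@(_ ∷ _)} {C} (_ , refuteRestriction) (cC , F⊨C , _) (yes sat) =
  let D' , D'∈ , short = refutable⇒short-clause
        (refuteRestriction (sat , λ ()) (falsify C) (entailed⇒falsify-unsat cC F⊨C))
  in restriction-near cC D'∈ short

⊨-resp-⊆ : ∀ {F C D} → C ⊆ D → F ⊨ C → F ⊨ D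
⊨-resp-⊆ C⊆D F⊨C α sat =
  let l , l∈C , lTrue = find (F⊨C α sat) in lose (C⊆D l l∈C) lTrue

IsClause-filter : ∀ {P : Pred Lit 0ℓ} (P? : Decidable P) {E} → IsClause E → IsClause (filter P? E)
IsClause-filter P? (unique , noClash) =
  Unique.filter⁺ P? unique ,
  λ l l∈ l̅∈ → noClash l (proj₁ (∈-filter⁻ P? l∈)) (proj₁ (∈-filter⁻ P? l̅∈))

module _ (F : ClauseSet) where

  HasProperImplicate : Clause → Set
  HasProperImplicate E = ∃[ C ] (IsClause C × C ⊆ E × F ⊨ C × Any (_∉ C) E)

  prime-below : ∀ E → Acc (_<_ on length) E → IsClause E → F ⊨ E →
    ¬ ¬ (∃[ P ] (IsPrimeImplicate F P × P ⊑ E))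
  prime-below E (acc smaller) cE F⊨E = do
    yes (C , cC , C⊆E , F⊨C , missing) ← ¬¬-excluded-middle {A = HasProperImplicate E}
      where no none → pure (E , (cE , F⊨E , minimal none) , ⊆-refl)
    let inC = _∈? C
        C⊆E∩C = λ l l∈C → ∈-filter⁺ inC (C⊆E l l∈C) l∈C
    P , prime , P⊑ ← prime-below (filter inC E) (smaller (filter-notAll inC E missing))
                       (IsClause-filter inC cE) (⊨-resp-⊆ C⊆E∩C F⊨C)
    pure (P , prime , ⊆-trans P⊑ (filter-⊆ inC E))
    where
    minimal : ¬ HasProperImplicate E → ∀ C → IsClause C → C ⊆ E → F ⊨ C → E ⊆ C
    minimal none C cC C⊆E F⊨C l l∈E =
      decidable-stable (l ∈? C) λ l∉C → none (C , cC , C⊆E , F⊨C , lose l∈E l∉C)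

  prime-implicate-below : ∀ {E} → IsClause E → F ⊨ E → ¬ ¬ (∃[ P ] (IsPrimeImplicate F P × P ⊑ E))
  prime-implicate-below {E} = prime-below E (On.wellFounded length <-wellFounded E)

module _ {A B : Set} {R : A → B → Set} where

  ¬¬-partners : ∀ ys → (∀ {y} → y ∈ ys → ¬ ¬ (∃[ x ] R x y)) → ¬ ¬ (∃[ xs ] Pointwise R xs ys)
  ¬¬-partners [] _ = pure ([] , [])
  ¬¬-partners (y ∷ ys) partner = do
    x , r ← partner (here refl)
    xs , rs ← ¬¬-partners ys (partner ∘ there)
    pure (x ∷ xs , r ∷ rs)

  Pointwise-partner : ∀ {xs ys y} → Pointwise R xs ys → y ∈ ys → Any (λ x → R x y) xs
  Pointwise-partner (r ∷ _)  (here refl) = here r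
  Pointwise-partner (_ ∷ rs) (there y∈)  = there (Pointwise-partner rs y∈)

  Pointwise-Allˡ : ∀ {P : A → Set} {xs ys} → (∀ {x y} → R x y → P x) → Pointwise R xs ys → All P xs
  Pointwise-Allˡ f []       = []
  Pointwise-Allˡ f (r ∷ rs) = f r ∷ Pointwise-Allˡ f rs

below-transversal : ∀ {k F T} → WC k F → Dec (Satisfiable F) →
  Pointwise (λ P D → IsPrimeImplicate F P × P ⊑ D) T F → IsTransversal k F T
below-transversal wc sat? below =
  Pointwise-Allˡ proj₁ below ,
  λ C prime → let D , D∈F , near = prime-implicate-near wc prime sat? in
    Any.map (λ (primeP , P⊑D) → primeP , Near-⊑ P⊑D near) (Pointwise-partner below D∈F)

theorem6p4 : (k : ℕ) (F : ClauseSet) → IsClauseSet F → WC k F →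
    (t : ℕ) → IsTransversalNumber k F t → t ≤ c F
theorem6p4 k F (clauses , _) wc t (_ , minimal) = decidable-stable (t ≤? c F) $ do
  T , below ← ¬¬-partners F λ D∈F →
    prime-implicate-below F (All.lookup clauses D∈F) (λ α sat → All.lookup sat D∈F)
  sat? ← ¬¬-excluded-middle
  pure (≤-trans (minimal T (below-transversal wc sat? below)) (≤-reflexive (Pointwise-length below)))
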